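{- Let $T$ be a tree on $n$ vertices that is isomorphic neither to the star $K_{1,n-1}$ nor to the path $P_n$. Let $r$ be any leaf of $T$, let $r'$ be the unique neighbor of $r$, and let $T'=T-r$. Let $W(T')$ be the number of $P_3$-convex sets of $T'$ that do not contain $r'$, and let $\Gamma(T')$ be the number of $P_3$-convex sets of $T'$ that contain neither $r'$ nor any neighbor of $r'$ in $T'$. Then: (1) $W(T')-\Gamma(T')\ge n-1$; (2) $noc(T)<2^{n-1}+n=noc(K_{1,n-1})$.
   Context: For a finite simple undirected graph $G=(V,E)$, a set $S\subseteq V$ is called $P_3$-convex if for every path $x$--$z$--$y$ in $G$ (distinct vertices $x,z,y$ with $xz,zy\in E$) with $x,y\in S$, we also have $z\in S$. The number $noc(G)$ denotes the number of $P_3$-convex subsets of $V$ (including $\emptyset$). In the paper, $W(T')$ and $\Gamma(T')$ are written $noc(T',\mathsf{W})$ and $noc(T',\mathsf{G})$ for $T'$ rooted at $r'$ (root white; root white with a black parent, respectively). -}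

module Defs where

open import Data.Nat using (ℕ; zero; suc; _≡ᵇ_)
open import Data.Bool using (Bool; true; false; T; T?; _∨_; _xor_; not)
open import Data.Bool.Properties using (∨-comm)
open import Data.Fin using (Fin; zero; suc; toℕ; punchIn; _≟_)
open import Data.Fin.Properties using (all?)
open import Data.Fin.Subset using (Subset; _∈_; _∉_)
open import Data.Fin.Subset.Properties using (_∈?_)
open import Data.Fin.Permutation using (Permutation′; _⟨$⟩ʳ_)
open import Data.List using (List; []; _∷_; _++_; map; filter; length; allFin; _∷ʳ_)
open import Data.List.Relation.Unary.Unique.Propositional using (Unique)
open import Data.List.Relation.Unary.Linked using (Linked)
open import Data.Vec using ([]; _∷_)
open import Data.Product using (Σ; ∃; _×_; _,_)
open import Relation.Binary.PropositionalEquality using (_≡_; _≢_; refl)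
open import Relation.Nullary using (Dec; ¬_; ¬?; _→-dec_; _×-dec_)
open import Data.Nat using (_≤_)

record Graph (n : ℕ) : Set where
  field
    adj    : Fin n → Fin n → Bool
    sym    : ∀ i j → adj i j ≡ adj j i
    irrefl : ∀ i → adj i i ≡ false
open Graph public

Edge : ∀ {n} → Graph n → Fin n → Fin n → Set
Edge G i j = T (adj G i j)

data Walk {n} (G : Graph n) : Fin n → Fin n → Set where
  here : ∀ {u} → Walk G u u
  step : ∀ {u v w} → Edge G u v → Walk G v w → Walk G u w

Connected : ∀ {n} → Graph n → Set
Connected {n} G = ∀ (u v : Fin n) → Walk G u v

-- A cycle: distinct vertices x, y1, ..., yk (k ≥ 2), consecutive ones adjacent,
-- and yk adjacent to x.
HasCycle : ∀ {n} → Graph n → Set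
HasCycle {n} G = Σ (Fin n) λ x → Σ (List (Fin n)) λ ys →
  (2 ≤ length ys) × Unique (x ∷ ys) × Linked (Edge G) (x ∷ ys ∷ʳ x)

IsTree : ∀ {n} → Graph n → Set
IsTree G = Connected G × ¬ HasCycle G

degree : ∀ {n} → Graph n → Fin n → ℕ
degree {n} G v = length (filter (λ u → T? (adj G v u)) (allFin n))

IsLeaf : ∀ {n} → Graph n → Fin n → Set
IsLeaf G v = degree G v ≡ 1

-- Deleting a vertex r from a graph on Fin (suc m); vertex j of G - r is
-- vertex (punchIn r j) of G.
deleteVertex : ∀ {m} → Graph (suc m) → Fin (suc m) → Graph m
deleteVertex G r = record
  { adj    = λ i j → adj G (punchIn r i) (punchIn r j)
  ; sym    = λ i j → sym G (punchIn r i) (punchIn r j)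
  ; irrefl = λ i → irrefl G (punchIn r i)
  }

_≅_ : ∀ {n} → Graph n → Graph n → Set
_≅_ {n} G H = Σ (Permutation′ n) λ π →
  ∀ i j → adj G i j ≡ adj H (π ⟨$⟩ʳ i) (π ⟨$⟩ʳ j)

isZero : ∀ {n} → Fin n → Bool
isZero zero    = true
isZero (suc _) = false

xor-comm : ∀ a b → a xor b ≡ b xor a
xor-comm true  true  = refl
xor-comm true  false = refl
xor-comm false true  = refl
xor-comm false false = refl

xor-self : ∀ a → a xor a ≡ false
xor-self true  = refl
xor-self false = refl

star : ∀ n → Graph n
star n = record
  { adj    = λ i j → isZero i xor isZero j
  ; sym    = λ i j → xor-comm (isZero i) (isZero j)
  ; irrefl = λ i → xor-self (isZero i)
  }

suc≢ᵇ : ∀ k → (suc k ≡ᵇ k) ≡ false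
suc≢ᵇ zero    = refl
suc≢ᵇ (suc k) = suc≢ᵇ k

pathGraph : ∀ n → Graph n
pathGraph n = record
  { adj    = λ i j → (suc (toℕ i) ≡ᵇ toℕ j) ∨ (suc (toℕ j) ≡ᵇ toℕ i)
  ; sym    = λ i j → ∨-comm (suc (toℕ i) ≡ᵇ toℕ j) (suc (toℕ j) ≡ᵇ toℕ i)
  ; irrefl = λ i → irr (toℕ i)
  }
  where
  irr : ∀ k → ((suc k ≡ᵇ k) ∨ (suc k ≡ᵇ k)) ≡ false
  irr k with suc k ≡ᵇ k | suc≢ᵇ k
  ... | false | _ = refl

-- P3-convexity: for every path x - z - y (x, y, z distinct) with x, y ∈ S, z ∈ S.
-- (z ≠ x and z ≠ y follow from looplessness.)
IsP3Convex : ∀ {n} → Graph n → Subset n → Set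
IsP3Convex G S = ∀ x z y → x ≢ y → Edge G x z → Edge G z y → x ∈ S → y ∈ S → z ∈ S

isP3Convex? : ∀ {n} (G : Graph n) (S : Subset n) → Dec (IsP3Convex G S)
isP3Convex? G S = all? λ x → all? λ z → all? λ y →
  ¬? (x ≟ y) →-dec T? (adj G x z) →-dec T? (adj G z y) →-dec
  (x ∈? S) →-dec (y ∈? S) →-dec (z ∈? S)

allSubsets : ∀ n → List (Subset n)
allSubsets zero    = [] ∷ []
allSubsets (suc n) = map (false ∷_) (allSubsets n) ++ map (true ∷_) (allSubsets n)

countSubsets : ∀ n {P : Subset n → Set} → ((S : Subset n) → Dec (P S)) → ℕ
countSubsets n P? = length (filter P? (allSubsets n))

noc : ∀ {n} → Graph n → ℕ
noc {n} G = countSubsets n (isP3Convex? G)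

W : ∀ {n} → Graph n → Fin n → ℕ
W {n} G v = countSubsets n (λ S → isP3Convex? G S ×-dec ¬? (v ∈? S))

Γ : ∀ {n} → Graph n → Fin n → ℕ
Γ {n} G v = countSubsets n (λ S → isP3Convex? G S ×-dec ¬? (v ∈? S) ×-dec
  all? (λ u → T? (adj G v u) →-dec ¬? (u ∈? S)))

-- Root T′ = T − r at r′. The sets counted by W − Γ are the convex sets avoiding r′ but meeting
-- its neighbourhood. For each of the n − 2 vertices v ≠ r′ of T′, the path from v up to r′
-- (without r′) is such a set; these sets are closed under non-root ancestors and totally
-- ordered by ancestry. If some non-root vertex has two children, or some neighbour a of r′ lies
-- off the path of a vertex x of depth ≥ 3 (then a and x are at distance ≥ 3), there is one more
-- such set, which is not of that form. Otherwise either each depth holds at most one vertex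
-- or all depths are ≤ 2, and T is a path or a star. Hence W − Γ ≥ n − 1 in part (1).
-- Splitting the convex sets of T by whether they contain the leaf r gives
-- noc T + W = 2 noc T′ + Γ, so noc T ≤ 2 noc T′ − (n − 1). With noc T′ ≤ 2^(n−2) + n − 1,
-- obtained from the same identity by induction (deleting a deepest leaf, where only
-- W − Γ ≥ n − 2 is available), this gives part (2).

module Submission where

open import Defs hiding (sym)
open import Data.Bool using (Bool; true; false; T; T?; _xor_)
open import Data.Bool.Properties using (T-∨)
open import Data.Empty using (⊥; ⊥-elim)
open import Data.Fin using (Fin; zero; suc; toℕ; fromℕ<; punchIn; punchOut; _≟_)
open import Data.Fin.Properties using (all?; any?; toℕ-fromℕ<; punchIn-injective; punchInᵢ≢i; punchIn-punchOut; punchOut-injective; injective⇒≤)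
import Data.Fin.Properties as Fin
open import Data.Fin.Permutation using (Permutation′; permutation; transpose)
import Data.Fin.Permutation.Components as PC
open import Data.Fin.Subset using (Subset; _∈_; _∉_; Empty)
open import Data.Fin.Subset.Properties using (_∈?_; nonempty?; drop-∷-Empty)
open import Data.List as List using (List; []; _∷_; _++_; _∷ʳ_; map; filter; length; allFin)
open import Data.List.Extrema.Nat using (argmax; f[xs]≤f[argmax])
open import Data.List.Properties using (length-++; length-map; length-tabulate; length-removeAt′; length-filter; filter-++; filter-all; filter-none; filter-≐; map-++; ≡-dec; ∷-injective; ∷-injectiveˡ; ∷-injectiveʳ)
open import Data.List.Membership.Propositional using () renaming (_∈_ to _∈ₗ_; _∉_ to _∉ₗ_)
import Data.List.Membership.DecPropositional as DecMembership
open import Data.List.Membership.Propositional.Properties using (∈-map⁺; ∈-map⁻; ∈-++⁺ˡ; ∈-++⁺ʳ; ∈-++⁻; ∈-filter⁺; ∈-allFin)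
open import Data.List.Relation.Unary.All as All using (All; []; _∷_)
open import Data.List.Relation.Unary.All.Properties using (¬Any⇒All¬; ++⁻ʳ)
import Data.List.Relation.Unary.All.Properties as AllProperties
open import Data.List.Relation.Unary.AllPairs using ([]; _∷_)
open import Data.List.Relation.Unary.Any as Any using (here; there; _─_)
open import Data.List.Relation.Unary.Linked using (Linked; [-]; _∷_)
import Data.List.Relation.Unary.Linked.Properties as LinkedProperties
open import Data.List.Relation.Unary.Unique.Propositional using (Unique)
import Data.List.Relation.Unary.Unique.Propositional.Properties as UniqueProperties
open import Data.Nat using (ℕ; zero; suc; pred; _+_; _*_; _∸_; _^_; _≤_; _<_; _≤?_; z≤n; s≤s; >-nonZero)
open import Data.Nat.Properties using (+-suc; +-identityʳ; +-comm; +-assoc; +-mono-≤; +-monoʳ-≤; +-cancelʳ-≤; suc-injective; suc-pred; 1+n≰n; m≢1+n+m; m≤n+m; ≤-refl; ≤-reflexive; ≤-trans; ≤-antisym; ≤-pred; ≰⇒>; <-irrefl; ≡ᵇ⇒≡; ≡⇒≡ᵇ; module ≤-Reasoning)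
open import Data.Nat.Tactic.RingSolver using (solve-∀)
open import Data.Product using (∃; _×_; _,_; proj₁; proj₂)
open import Data.Sum using (_⊎_; inj₁; inj₂; [_,_]′)
open import Data.Unit using (⊤; tt)
open import Data.Vec using ([]; _∷_; here; there; tabulate; insertAt)
open import Data.Vec.Properties using (lookup∘tabulate; []=⇒lookup; lookup⇒[]=; insertAt-lookup; insertAt-punchIn)
open import Function using (_∘_)
open import Function.Bundles using (Equivalence)
open import Function.Definitions using (Injective)
open import Level using (0ℓ)
open import Relation.Binary.PropositionalEquality using (_≡_; _≢_; refl; sym; trans; cong; cong₂; subst; module ≡-Reasoning)
open import Relation.Nullary using (Dec; yes; no; does; ¬_)
open import Relation.Nullary.Decidable using (_×-dec_; _⊎-dec_; _→-dec_; ¬?; dec-true)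
open import Relation.Unary using (Pred; Decidable; _≐_)

module _ {A : Set} where

  ∈-─ : ∀ {x y : A} {xs} (x∈xs : x ∈ₗ xs) → y ∈ₗ xs → y ≢ x → y ∈ₗ (xs ─ x∈xs)
  ∈-─ (here refl) (here refl) y≢x = ⊥-elim (y≢x refl)
  ∈-─ (here refl) (there y∈xs) _ = y∈xs
  ∈-─ (there _) (here refl) _ = here refl
  ∈-─ (there x∈xs) (there y∈xs) y≢x = there (∈-─ x∈xs y∈xs y≢x)

  Unique⇒length≤ : ∀ {xs ys : List A} → Unique xs → (∀ {x} → x ∈ₗ xs → x ∈ₗ ys) → length xs ≤ length ys
  Unique⇒length≤ {[]} _ _ = z≤n
  Unique⇒length≤ {x ∷ xs} {ys} (x∉xs ∷ xs!) xs⊆ys = ≤-trans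
    (s≤s (Unique⇒length≤ xs! λ y∈xs → ∈-─ x∈ys (xs⊆ys (there y∈xs)) λ { refl → All.lookup x∉xs y∈xs refl }))
    (≤-reflexive (sym (length-removeAt′ ys _)))
    where
    x∈ys : x ∈ₗ ys
    x∈ys = xs⊆ys (here refl)

  ++-suffix-unique : ∀ (pre pre′ : List A) {ys ys′} →
    pre ++ ys ≡ pre′ ++ ys′ → length ys ≡ length ys′ → ys ≡ ys′
  ++-suffix-unique [] [] eq _ = eq
  ++-suffix-unique (_ ∷ pre) (_ ∷ pre′) eq l = ++-suffix-unique pre pre′ (∷-injectiveʳ eq) l
  ++-suffix-unique [] (_ ∷ pre′) {ys′ = ys′} refl l =
    ⊥-elim (m≢1+n+m (length ys′) (trans (sym l) (cong suc (length-++ pre′))))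
  ++-suffix-unique (_ ∷ pre) [] {ys} refl l =
    ⊥-elim (m≢1+n+m (length ys) (trans l (cong suc (length-++ pre))))

  ++-suffix-comparable : ∀ (pre pre′ : List A) {y z ys zs} →
    pre ++ (y ∷ ys) ≡ pre′ ++ (z ∷ zs) → y ∈ₗ z ∷ zs ⊎ z ∈ₗ y ∷ ys
  ++-suffix-comparable [] [] eq = inj₁ (here (proj₁ (∷-injective eq)))
  ++-suffix-comparable (_ ∷ pre) (_ ∷ pre′) eq = ++-suffix-comparable pre pre′ (∷-injectiveʳ eq)
  ++-suffix-comparable [] (_ ∷ pre′) refl = inj₂ (there (∈-++⁺ʳ pre′ (here refl)))
  ++-suffix-comparable (_ ∷ pre) [] refl = inj₁ (there (∈-++⁺ʳ pre (here refl)))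

_∈ₗ?_ : ∀ {n} (x : Fin n) (xs : List (Fin n)) → Dec (x ∈ₗ xs)
_∈ₗ?_ = DecMembership._∈?_ _≟_

module _ {A B : Set} {P : Pred B 0ℓ} (P? : Decidable P) (f : A → B) where

  length-filter-map : ∀ xs → length (filter P? (map f xs)) ≡ length (filter (P? ∘ f) xs)
  length-filter-map [] = refl
  length-filter-map (x ∷ xs) with does (P? (f x))
  ... | true = cong suc (length-filter-map xs)
  ... | false = length-filter-map xs

module _ {A : Set} {P Q : Pred A 0ℓ} (P? : Decidable P) (Q? : Decidable Q) where

  length-filter-split : ∀ xs → length (filter P? xs) ≡
    length (filter (λ x → P? x ×-dec Q? x) xs) + length (filter (λ x → P? x ×-dec ¬? (Q? x)) xs)
  length-filter-split [] = refl
  length-filter-split (x ∷ xs) with P? x | Q? x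
  ... | yes _ | yes _ = cong suc (length-filter-split xs)
  ... | yes _ | no _ = trans (cong suc (length-filter-split xs)) (sym (+-suc _ _))
  ... | no _ | yes _ = length-filter-split xs
  ... | no _ | no _ = length-filter-split xs

-- Counting subsets

allSubsets-complete : ∀ n (S : Subset n) → S ∈ₗ allSubsets n
allSubsets-complete zero [] = here refl
allSubsets-complete (suc n) (false ∷ S) = ∈-++⁺ˡ (∈-map⁺ (false ∷_) (allSubsets-complete n S))
allSubsets-complete (suc n) (true ∷ S) =
  ∈-++⁺ʳ (map (false ∷_) (allSubsets n)) (∈-map⁺ (true ∷_) (allSubsets-complete n S))

length-allSubsets : ∀ n → length (allSubsets n) ≡ 2 ^ n
length-allSubsets zero = refl
length-allSubsets (suc n) = begin
  length (map (false ∷_) (allSubsets n) ++ map (true ∷_) (allSubsets n))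
    ≡⟨ length-++ (map (false ∷_) (allSubsets n)) ⟩
  length (map (false ∷_) (allSubsets n)) + length (map (true ∷_) (allSubsets n))
    ≡⟨ cong₂ _+_ (length-map _ (allSubsets n)) (length-map _ (allSubsets n)) ⟩
  length (allSubsets n) + length (allSubsets n)
    ≡⟨ cong₂ _+_ (length-allSubsets n) (trans (length-allSubsets n) (sym (+-identityʳ _))) ⟩
  2 ^ suc n ∎
  where open ≡-Reasoning

module _ (n : ℕ) {P : Pred (Subset n) 0ℓ} (P? : Decidable P) where

  countSubsets-≤ : countSubsets n P? ≤ 2 ^ n
  countSubsets-≤ = ≤-trans (length-filter P? (allSubsets n)) (≤-reflexive (length-allSubsets n))

  countSubsets-all : (∀ S → P S) → countSubsets n P? ≡ 2 ^ n
  countSubsets-all p = trans (cong length (filter-all P? {allSubsets n} (All.tabulate λ {S} _ → p S))) (length-allSubsets n)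

  countSubsets-none : (∀ S → ¬ P S) → countSubsets n P? ≡ 0
  countSubsets-none ¬p = cong length (filter-none P? {allSubsets n} (All.tabulate λ {S} _ → ¬p S))

  length≤countSubsets : ∀ {Ss} → Unique Ss → All P Ss → length Ss ≤ countSubsets n P?
  length≤countSubsets Ss! pSs = Unique⇒length≤ Ss! λ {S} S∈Ss →
    ∈-filter⁺ P? (allSubsets-complete n S) (All.lookup pSs S∈Ss)

  module _ {Q : Pred (Subset n) 0ℓ} (Q? : Decidable Q) where

    countSubsets-cong : P ≐ Q → countSubsets n P? ≡ countSubsets n Q?
    countSubsets-cong P≐Q = cong length (filter-≐ P? Q? P≐Q (allSubsets n))

    countSubsets-split : countSubsets n P? ≡
      countSubsets n (λ S → P? S ×-dec Q? S) + countSubsets n (λ S → P? S ×-dec ¬? (Q? S))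
    countSubsets-split = length-filter-split P? Q? (allSubsets n)

module _ (n : ℕ) {P : Pred (Subset (suc n)) 0ℓ} (P? : Decidable P) where

  countSubsets-suc : countSubsets (suc n) P? ≡
    countSubsets n (λ S → P? (false ∷ S)) + countSubsets n (λ S → P? (true ∷ S))
  countSubsets-suc = begin
    length (filter P? (Fs ++ Ts))
      ≡⟨ cong length (filter-++ P? Fs Ts) ⟩
    length (filter P? Fs ++ filter P? Ts)
      ≡⟨ length-++ (filter P? Fs) ⟩
    length (filter P? Fs) + length (filter P? Ts)
      ≡⟨ cong₂ _+_ (length-filter-map P? (false ∷_) (allSubsets n)) (length-filter-map P? (true ∷_) (allSubsets n)) ⟩
    countSubsets n (λ S → P? (false ∷ S)) + countSubsets n (λ S → P? (true ∷ S)) ∎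
    where
    open ≡-Reasoning
    Fs Ts : List (Subset (suc n))
    Fs = map (false ∷_) (allSubsets n)
    Ts = map (true ∷_) (allSubsets n)

countSubsets-insertAt : ∀ n (r : Fin (suc n)) {P : Pred (Subset (suc n)) 0ℓ} (P? : Decidable P) →
  countSubsets (suc n) P? ≡
    countSubsets n (λ S → P? (insertAt S r false)) + countSubsets n (λ S → P? (insertAt S r true))
countSubsets-insertAt n zero P? = countSubsets-suc n P?
countSubsets-insertAt (suc n) (suc r) P? = begin
  countSubsets (suc (suc n)) P?
    ≡⟨ countSubsets-suc (suc n) P? ⟩
  countSubsets (suc n) (P? ∘ (false ∷_)) + countSubsets (suc n) (P? ∘ (true ∷_))
    ≡⟨ cong₂ _+_ (countSubsets-insertAt n r (P? ∘ (false ∷_))) (countSubsets-insertAt n r (P? ∘ (true ∷_))) ⟩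
  (count false false + count false true) + (count true false + count true true)
    ≡⟨ interchange (count false false) (count false true) (count true false) (count true true) ⟩
  (count false false + count true false) + (count false true + count true true)
    ≡⟨ sym (cong₂ _+_ (countSubsets-suc n (λ S → P? (insertAt S (suc r) false)))
                      (countSubsets-suc n (λ S → P? (insertAt S (suc r) true)))) ⟩
  countSubsets (suc n) (λ S → P? (insertAt S (suc r) false)) + countSubsets (suc n) (λ S → P? (insertAt S (suc r) true)) ∎
  where
  open ≡-Reasoning
  count : Bool → Bool → ℕ
  count b c = countSubsets n (λ S → P? (b ∷ insertAt S r c))
  interchange : ∀ a b c d → (a + b) + (c + d) ≡ (a + c) + (b + d)
  interchange = solve-∀

-- Paths and rooted trees

module Paths {n : ℕ} (G : Graph n) where

  Edge-sym : ∀ {u v} → Edge G u v → Edge G v u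
  Edge-sym {u} {v} = subst T (Graph.sym G u v)

  Edge⇒≢ : ∀ {u v} → Edge G u v → u ≢ v
  Edge⇒≢ {u} e refl = subst T (Graph.irrefl G u) e

  data WalkWithin (Q : Pred (Fin n) 0ℓ) : Fin n → Fin n → Set where
    stay : ∀ {u} → Q u → WalkWithin Q u u
    hop  : ∀ {u w v} → Q u → Edge G u w → WalkWithin Q w v → WalkWithin Q u v

  module _ {Q : Pred (Fin n) 0ℓ} where

    WalkWithin-start : ∀ {u v} → WalkWithin Q u v → Q u
    WalkWithin-start (stay q) = q
    WalkWithin-start (hop q _ _) = q

    _++ʷ_ : ∀ {u v w} → WalkWithin Q u v → WalkWithin Q v w → WalkWithin Q u w
    stay _ ++ʷ q = q
    hop qu e p ++ʷ q = hop qu e (p ++ʷ q)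

    reverseʷ : ∀ {u v} → WalkWithin Q u v → WalkWithin Q v u
    reverseʷ (stay q) = stay q
    reverseʷ (hop qu e p) = reverseʷ p ++ʷ hop (WalkWithin-start p) (Edge-sym e) (stay qu)

  Walk⇒WalkWithin : ∀ {u v} → Walk G u v → WalkWithin (λ _ → ⊤) u v
  Walk⇒WalkWithin here = stay tt
  Walk⇒WalkWithin (step e w) = hop tt e (Walk⇒WalkWithin w)

  data SimplePath : Fin n → Fin n → List (Fin n) → Set where
    single : ∀ {u} → SimplePath u u (u ∷ [])
    extend : ∀ {u w v vs} → Edge G u w → u ∉ₗ vs → SimplePath w v vs → SimplePath u v (u ∷ vs)

  SimplePath-head : ∀ {u v vs} → SimplePath u v vs → ∃ λ t → vs ≡ u ∷ t
  SimplePath-head single = _ , refl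
  SimplePath-head (extend _ _ _) = _ , refl

  SimplePath-end : ∀ {u v vs} → SimplePath u v vs → v ∈ₗ vs
  SimplePath-end single = here refl
  SimplePath-end (extend _ _ p) = there (SimplePath-end p)

  SimplePath⇒Unique : ∀ {u v vs} → SimplePath u v vs → Unique vs
  SimplePath⇒Unique single = [] ∷ []
  SimplePath⇒Unique (extend {vs = vs} _ u∉vs p) = ¬Any⇒All¬ vs u∉vs ∷ SimplePath⇒Unique p

  SimplePath-suffix : ∀ {u w v vs} → SimplePath w v vs → u ∈ₗ vs →
    ∃ λ pre → ∃ λ ys → SimplePath u v ys × vs ≡ pre ++ ys
  SimplePath-suffix single (here refl) = [] , _ , single , refl
  SimplePath-suffix p@(extend _ _ _) (here refl) = [] , _ , p , refl
  SimplePath-suffix (extend {u = w} _ _ p) (there u∈vs) with SimplePath-suffix p u∈vs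
  ... | pre , ys , q , refl = w ∷ pre , ys , q , refl

  shorten : ∀ {Q u v} → WalkWithin Q u v → ∃ λ vs → SimplePath u v vs × All Q vs
  shorten (stay q) = _ , single , q ∷ []
  shorten {u = u} (hop qu e p) with shorten p
  ... | vs , sp , qs with u ∈ₗ? vs
  ...   | no u∉vs = u ∷ vs , extend e u∉vs sp , qu ∷ qs
  ...   | yes u∈vs with SimplePath-suffix sp u∈vs
  ...     | pre , ys , sp′ , refl = ys , sp′ , ++⁻ʳ pre qs

  SimplePath⇒WalkWithin : ∀ {Q u v vs} → SimplePath u v vs → All Q vs → WalkWithin Q u v
  SimplePath⇒WalkWithin single (q ∷ []) = stay q
  SimplePath⇒WalkWithin (extend e _ p) (q ∷ qs) = hop q e (SimplePath⇒WalkWithin p qs)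

  private
    length≥2 : ∀ {u v vs} → SimplePath u v vs → u ≢ v → 2 ≤ length vs
    length≥2 single u≢v = ⊥-elim (u≢v refl)
    length≥2 (extend _ _ single) _ = s≤s (s≤s z≤n)
    length≥2 (extend _ _ (extend _ _ _)) _ = s≤s (s≤s z≤n)

    bracketed-linked : ∀ {s a b t vs} → Edge G s a → SimplePath a b vs → Edge G b t → Linked (Edge G) (s ∷ vs ∷ʳ t)
    bracketed-linked e₁ single e₂ = e₁ ∷ e₂ ∷ [-]
    bracketed-linked e₁ (extend e _ p) e₂ = e₁ ∷ bracketed-linked e p e₂

  module Acyclic (acyclic : ¬ HasCycle G) where

    no-detour : ∀ {u w₁ w₂} → Edge G u w₁ → Edge G u w₂ → w₁ ≢ w₂ → ¬ WalkWithin (u ≢_) w₁ w₂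
    no-detour {u} e₁ e₂ w₁≢w₂ walk with shorten walk
    ... | vs , p , u∉vs = acyclic
      (u , vs , length≥2 p w₁≢w₂ , u∉vs ∷ SimplePath⇒Unique p , bracketed-linked e₁ p (Edge-sym e₂))

    SimplePath-unique : ∀ {u v vs ws} → SimplePath u v vs → SimplePath u v ws → vs ≡ ws
    SimplePath-unique single single = refl
    SimplePath-unique single (extend _ u∉ws p) = ⊥-elim (u∉ws (SimplePath-end p))
    SimplePath-unique (extend _ u∉vs p) single = ⊥-elim (u∉vs (SimplePath-end p))
    SimplePath-unique (extend {w = w₁} e₁ u∉vs p) (extend {w = w₂} e₂ u∉ws q) with w₁ ≟ w₂
    ... | yes refl = cong (_ ∷_) (SimplePath-unique p q)
    ... | no w₁≢w₂ = ⊥-elim (no-detour e₁ e₂ w₁≢w₂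
      (SimplePath⇒WalkWithin p (¬Any⇒All¬ _ u∉vs) ++ʷ reverseʷ (SimplePath⇒WalkWithin q (¬Any⇒All¬ _ u∉ws))))

module RootedTree {n : ℕ} (G : Graph n) (tree : IsTree G) (ρ : Fin n) where
  open Paths G
  open Acyclic (proj₂ tree)

  private
    toRoot-spec : ∀ v → ∃ λ vs → SimplePath v ρ vs × All (λ _ → ⊤) vs
    toRoot-spec v = shorten (Walk⇒WalkWithin (proj₁ tree v ρ))

  toRoot : Fin n → List (Fin n)
  toRoot v = proj₁ (toRoot-spec v)

  toRoot-path : ∀ v → SimplePath v ρ (toRoot v)
  toRoot-path v = proj₁ (proj₂ (toRoot-spec v))

  toRoot-unique : ∀ {v vs} → SimplePath v ρ vs → vs ≡ toRoot v
  toRoot-unique p = SimplePath-unique p (toRoot-path _)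

  -- depth counts the vertices of the path to the root, so depth ρ = 1.
  depth : Fin n → ℕ
  depth v = length (toRoot v)

  _≼_ : Fin n → Fin n → Set
  x ≼ v = x ∈ₗ toRoot v

  Child : Fin n → Fin n → Set
  Child c p = toRoot c ≡ c ∷ toRoot p

  toRoot-ρ : toRoot ρ ≡ ρ ∷ []
  toRoot-ρ = sym (toRoot-unique single)

  depth-ρ : depth ρ ≡ 1
  depth-ρ = cong length toRoot-ρ

  toRoot-head : ∀ v → ∃ λ t → toRoot v ≡ v ∷ t
  toRoot-head v = SimplePath-head (toRoot-path v)

  toRoot-injective : ∀ {u v} → toRoot u ≡ toRoot v → u ≡ v
  toRoot-injective {u} {v} eq with toRoot-head u | toRoot-head v
  ... | _ , hu | _ , hv = ∷-injectiveˡ (trans (sym hu) (trans eq hv))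

  ≼-refl : ∀ {v} → v ≼ v
  ≼-refl {v} with toRoot-head v
  ... | _ , h = subst (v ∈ₗ_) (sym h) (here refl)

  ≼⇒suffix : ∀ {x v} → x ≼ v → ∃ λ pre → toRoot v ≡ pre ++ toRoot x
  ≼⇒suffix x≼v with SimplePath-suffix (toRoot-path _) x≼v
  ... | pre , _ , p , eq = pre , trans eq (cong (pre ++_) (toRoot-unique p))

  ≼-trans : ∀ {x y v} → x ≼ y → y ≼ v → x ≼ v
  ≼-trans {x} x≼y y≼v with ≼⇒suffix y≼v
  ... | pre , eq = subst (x ∈ₗ_) (sym eq) (∈-++⁺ʳ pre x≼y)

  ≼⇒depth≤ : ∀ {x v} → x ≼ v → depth x ≤ depth v
  ≼⇒depth≤ {x} x≼v with ≼⇒suffix x≼v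
  ... | pre , eq = subst (depth x ≤_) (sym (trans (cong length eq) (length-++ pre))) (m≤n+m (depth x) (length pre))

  ≼-depth-injective : ∀ {x y v} → x ≼ v → y ≼ v → depth x ≡ depth y → x ≡ y
  ≼-depth-injective x≼v y≼v eq with ≼⇒suffix x≼v | ≼⇒suffix y≼v
  ... | pre , ex | pre′ , ey = toRoot-injective (++-suffix-unique pre pre′ (trans (sym ex) ey) eq)

  ≼-antisym : ∀ {x y} → x ≼ y → y ≼ x → x ≡ y
  ≼-antisym x≼y y≼x = ≼-depth-injective ≼-refl y≼x (≤-antisym (≼⇒depth≤ x≼y) (≼⇒depth≤ y≼x))

  ≼-comparable : ∀ {x y v} → x ≼ v → y ≼ v → x ≼ y ⊎ y ≼ x
  ≼-comparable {x} {y} x≼v y≼v with ≼⇒suffix x≼v | ≼⇒suffix y≼v | toRoot-head x | toRoot-head y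
  ... | pre , ex | pre′ , ey | _ , hx | _ , hy
    with ++-suffix-comparable pre pre′ (trans (cong (pre ++_) (sym hx)) (trans (sym ex) (trans ey (cong (pre′ ++_) hy))))
  ... | inj₁ x∈ = inj₁ (subst (x ∈ₗ_) (sym hy) x∈)
  ... | inj₂ y∈ = inj₂ (subst (y ∈ₗ_) (sym hx) y∈)

  Child-depth : ∀ {c p} → Child c p → depth c ≡ suc (depth p)
  Child-depth = cong length

  Child-parent-unique : ∀ {c p q} → Child c p → Child c q → p ≡ q
  Child-parent-unique cp cq = toRoot-injective (∷-injectiveʳ (trans (sym cp) cq))

  Child⇒≼ : ∀ {c p} → Child c p → p ≼ c
  Child⇒≼ {p = p} cp = subst (p ∈ₗ_) (sym cp) (there ≼-refl)

  ≼-Child : ∀ {y c p} → Child c p → y ≼ c → y ≡ c ⊎ y ≼ p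
  ≼-Child {y} cp y≼c with subst (y ∈ₗ_) cp y≼c
  ... | here y≡c = inj₁ y≡c
  ... | there y≼p = inj₂ y≼p

  Child⇒⋡ : ∀ {c p} → Child c p → ¬ c ≼ p
  Child⇒⋡ {c} cp c≼p with subst Unique cp (SimplePath⇒Unique (toRoot-path c))
  ... | c∉ ∷ _ = All.lookup c∉ c≼p refl

  ¬Child-ρ : ∀ {p} → ¬ Child ρ p
  ¬Child-ρ {p} ρp with toRoot-head p | ∷-injectiveʳ (trans (sym toRoot-ρ) ρp)
  ... | _ , h | eq with trans eq h
  ... | ()

  Edge⇒Child : ∀ {u w} → Edge G u w → Child u w ⊎ Child w u
  Edge⇒Child {u} {w} e with u ∈ₗ? toRoot w
  ... | no u⋠w = inj₁ (sym (toRoot-unique (extend e u⋠w (toRoot-path w))))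
  ... | yes u≼w with w ∈ₗ? toRoot u
  ...   | no w⋠u = inj₂ (sym (toRoot-unique (extend (Edge-sym e) w⋠u (toRoot-path u))))
  ...   | yes w≼u = ⊥-elim (Edge⇒≢ e (≼-antisym u≼w w≼u))

  Edge-ρ⇒Child : ∀ {x} → Edge G x ρ → Child x ρ
  Edge-ρ⇒Child e with Edge⇒Child e
  ... | inj₁ xρ = xρ
  ... | inj₂ ρx = ⊥-elim (¬Child-ρ ρx)

  depth-neighbour-ρ : ∀ {x} → Edge G ρ x → depth x ≡ 2
  depth-neighbour-ρ e = trans (Child-depth (Edge-ρ⇒Child (Edge-sym e))) (cong suc depth-ρ)

  parent : ∀ {v} → v ≢ ρ → ∃ λ p → Edge G v p × Child v p
  parent v≢ρ = first-step v≢ρ (toRoot-path _)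
    where
    first-step : ∀ {v vs} → v ≢ ρ → SimplePath v ρ vs → ∃ λ p → Edge G v p × Child v p
    first-step v≢ρ single = ⊥-elim (v≢ρ refl)
    first-step {v} _ p@(extend e _ q) = _ , e , trans (sym (toRoot-unique p)) (cong (v ∷_) (toRoot-unique q))

  depth≥1 : ∀ v → 1 ≤ depth v
  depth≥1 v with toRoot-head v
  ... | _ , h = subst (1 ≤_) (sym (cong length h)) (s≤s z≤n)

  depth≥2 : ∀ {v} → v ≢ ρ → 2 ≤ depth v
  depth≥2 v≢ρ with parent v≢ρ
  ... | p , _ , vp = subst (2 ≤_) (sym (Child-depth vp)) (s≤s (depth≥1 p))

  depth≥2⇒≢ρ : ∀ {v} → 2 ≤ depth v → v ≢ ρ
  depth≥2⇒≢ρ 2≤d refl with subst (2 ≤_) depth-ρ 2≤d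
  ... | s≤s ()

  depth≡1⇒ρ : ∀ {v} → depth v ≡ 1 → v ≡ ρ
  depth≡1⇒ρ {v} d with v ≟ ρ
  ... | yes v≡ρ = v≡ρ
  ... | no v≢ρ with subst (2 ≤_) d (depth≥2 v≢ρ)
  ...   | s≤s ()

  depth≡2⇒Edge-ρ : ∀ {v} → depth v ≡ 2 → Edge G v ρ
  depth≡2⇒Edge-ρ {v} d with parent (depth≥2⇒≢ρ (subst (2 ≤_) (sym d) ≤-refl))
  ... | p , vp-edge , vp with depth≡1⇒ρ {p} (suc-injective (trans (sym (Child-depth vp)) d))
  ...   | refl = vp-edge

  root-neighbour-≼ : ∀ {v} → v ≢ ρ → ∃ λ a → a ≼ v × Edge G a ρ
  root-neighbour-≼ v≢ρ = along v≢ρ (toRoot-path _)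
    where
    along : ∀ {v vs} → v ≢ ρ → SimplePath v ρ vs → ∃ λ a → a ∈ₗ vs × Edge G a ρ
    along v≢ρ single = ⊥-elim (v≢ρ refl)
    along {v} _ (extend {w = w} e _ q) with w ≟ ρ
    ... | yes refl = v , here refl , e
    ... | no w≢ρ with along w≢ρ q
    ...   | a , a∈ , ea = a , there a∈ , ea

  deepest-is-leaf : ∀ {v} → v ≢ ρ → (∀ u → depth u ≤ depth v) →
    ∃ λ p → Edge G v p × (∀ u → Edge G v u → u ≡ p)
  deepest-is-leaf {v} v≢ρ deepest with parent v≢ρ
  ... | p , vp-edge , vp = p , vp-edge , only-neighbour
    where
    only-neighbour : ∀ u → Edge G v u → u ≡ p
    only-neighbour u e with Edge⇒Child e
    ... | inj₁ vu = Child-parent-unique vu vp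
    ... | inj₂ uv = ⊥-elim (1+n≰n (subst (_≤ depth v) (Child-depth uv) (deepest u)))

  DepthInjective : Set
  DepthInjective = ∀ {u v} → depth u ≡ depth v → u ≡ v

  AncestorClosed : Subset n → Set
  AncestorClosed S = ∀ {x y} → x ∈ S → y ≼ x → y ≢ ρ → y ∈ S

  convex-criterion : ∀ S → AncestorClosed S →
    (∀ {x y} → x ∈ S → y ∈ S → Edge G ρ x → Edge G ρ y → x ≡ y) → IsP3Convex G S
  convex-criterion S closed one-neighbour x z y x≢y xz zy x∈S y∈S with z ≟ ρ
  ... | yes refl = ⊥-elim (x≢y (one-neighbour x∈S y∈S (Edge-sym xz) zy))
  ... | no z≢ρ with Edge⇒Child xz | Edge⇒Child (Edge-sym zy)
  ...   | inj₁ xz-child | _ = closed x∈S (Child⇒≼ xz-child) z≢ρ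
  ...   | inj₂ _ | inj₁ yz-child = closed y∈S (Child⇒≼ yz-child) z≢ρ
  ...   | inj₂ zx-child | inj₂ zy-child = ⊥-elim (x≢y (Child-parent-unique zx-child zy-child))

-- Convex sets meeting the neighbourhood of the root

module _ {n : ℕ} {P : Pred (Fin n) 0ℓ} (P? : Decidable P) where

  subsetOf : Subset n
  subsetOf = tabulate (does ∘ P?)

  ∈-subsetOf⁺ : ∀ {x} → P x → x ∈ subsetOf
  ∈-subsetOf⁺ {x} p = lookup⇒[]= x _ (trans (lookup∘tabulate (does ∘ P?) x) (dec-true (P? x) p))

  ∈-subsetOf⁻ : ∀ {x} → x ∈ subsetOf → P x
  ∈-subsetOf⁻ {x} x∈ with P? x | trans (sym (lookup∘tabulate (does ∘ P?) x)) ([]=⇒lookup x∈)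
  ... | yes p | _ = p
  ... | no _ | ()

AvoidsNeighbours : ∀ {n} → Graph n → Fin n → Pred (Subset n) 0ℓ
AvoidsNeighbours G ρ S = ∀ u → Edge G ρ u → u ∉ S

avoidsNeighbours? : ∀ {n} (G : Graph n) (ρ : Fin n) → Decidable (AvoidsNeighbours G ρ)
avoidsNeighbours? G ρ S = all? λ u → T? (adj G ρ u) →-dec ¬? (u ∈? S)

module TouchingSets {k : ℕ} (G : Graph (suc k)) (tree : IsTree G) (ρ : Fin (suc k)) where
  open Paths G
  open RootedTree G tree ρ

  ConvexTouching : Pred (Subset (suc k)) 0ℓ
  ConvexTouching S = (IsP3Convex G S × ρ ∉ S) × ¬ AvoidsNeighbours G ρ S

  convexTouching? : Decidable ConvexTouching
  convexTouching? S = (isP3Convex? G S ×-dec ¬? (ρ ∈? S)) ×-dec ¬? (avoidsNeighbours? G ρ S)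

  -- Every pathUp v has this shape and the extra sets found in TreeShape do not, so they are new.
  AncestorChain : Pred (Subset (suc k)) 0ℓ
  AncestorChain S = AncestorClosed S × (∀ {x y} → x ∈ S → y ∈ S → x ≼ y ⊎ y ≼ x)

  W≡Γ+touching : W G ρ ≡ Γ G ρ + countSubsets (suc k) convexTouching?
  W≡Γ+touching = trans (countSubsets-split (suc k) _ (avoidsNeighbours? G ρ))
    (cong (_+ countSubsets (suc k) convexTouching?)
      (countSubsets-cong (suc k) _ _ ((λ ((c , ρ∉) , a) → c , ρ∉ , a) , (λ (c , ρ∉ , a) → (c , ρ∉) , a))))

  nonRootAncestor? : ∀ v → Decidable (λ x → x ≢ ρ × x ≼ v)
  nonRootAncestor? v x = ¬? (x ≟ ρ) ×-dec (x ∈ₗ? toRoot v)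

  pathUp : Fin (suc k) → Subset (suc k)
  pathUp v = subsetOf (nonRootAncestor? v)

  module _ {v : Fin (suc k)} where

    ∈-pathUp⁺ : ∀ {x} → x ≢ ρ → x ≼ v → x ∈ pathUp v
    ∈-pathUp⁺ x≢ρ x≼v = ∈-subsetOf⁺ (nonRootAncestor? v) (x≢ρ , x≼v)

    ∈-pathUp⁻ : ∀ {x} → x ∈ pathUp v → x ≢ ρ × x ≼ v
    ∈-pathUp⁻ = ∈-subsetOf⁻ (nonRootAncestor? v)

    pathUp-AncestorChain : AncestorChain (pathUp v)
    pathUp-AncestorChain =
      (λ x∈ y≼x y≢ρ → ∈-pathUp⁺ y≢ρ (≼-trans y≼x (proj₂ (∈-pathUp⁻ x∈)))) ,
      (λ x∈ y∈ → ≼-comparable (proj₂ (∈-pathUp⁻ x∈)) (proj₂ (∈-pathUp⁻ y∈)))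

    pathUp-ConvexTouching : v ≢ ρ → ConvexTouching (pathUp v)
    pathUp-ConvexTouching v≢ρ = (convex , λ ρ∈ → proj₁ (∈-pathUp⁻ ρ∈) refl) , meets
      where
      convex : IsP3Convex G (pathUp v)
      convex = convex-criterion (pathUp v) (proj₁ pathUp-AncestorChain) λ x∈ y∈ ρx ρy →
        ≼-depth-injective (proj₂ (∈-pathUp⁻ x∈)) (proj₂ (∈-pathUp⁻ y∈))
          (trans (depth-neighbour-ρ ρx) (sym (depth-neighbour-ρ ρy)))
      meets : ¬ AvoidsNeighbours G ρ (pathUp v)
      meets avoids with root-neighbour-≼ v≢ρ
      ... | a , a≼v , aρ = avoids a (Edge-sym aρ) (∈-pathUp⁺ (Edge⇒≢ aρ) a≼v)

  pathUp-injective : ∀ {v w} → v ≢ ρ → w ≢ ρ → pathUp v ≡ pathUp w → v ≡ w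
  pathUp-injective {v} {w} v≢ρ w≢ρ eq = ≼-antisym
    (proj₂ (∈-pathUp⁻ (subst (v ∈_) eq (∈-pathUp⁺ v≢ρ ≼-refl))))
    (proj₂ (∈-pathUp⁻ (subst (w ∈_) (sym eq) (∈-pathUp⁺ w≢ρ ≼-refl))))

  pathUps : List (Subset (suc k))
  pathUps = List.tabulate (pathUp ∘ punchIn ρ)

  touching-≥ : ∀ extras → Unique extras → All ConvexTouching extras → All (¬_ ∘ AncestorChain) extras →
    length extras + k ≤ countSubsets (suc k) convexTouching?
  touching-≥ extras extras! extras-touching extras-¬chain = begin
    length extras + k                  ≡⟨ cong (length extras +_) (sym (length-tabulate (pathUp ∘ punchIn ρ))) ⟩
    length extras + length pathUps     ≡⟨ sym (length-++ extras) ⟩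
    length (extras List.++ pathUps)    ≤⟨ length≤countSubsets (suc k) convexTouching? all! all-touching ⟩
    countSubsets (suc k) convexTouching? ∎
    where
    open ≤-Reasoning
    pathUps! : Unique pathUps
    pathUps! = UniqueProperties.tabulate⁺ λ eq →
      punchIn-injective ρ _ _ (pathUp-injective (punchInᵢ≢i ρ _) (punchInᵢ≢i ρ _) eq)
    all! : Unique (extras List.++ pathUps)
    all! = UniqueProperties.++⁺ extras! pathUps! λ (S∈extras , S∈pathUps) →
      All.lookup extras-¬chain S∈extras
        (All.lookup (AllProperties.tabulate⁺ {P = AncestorChain} λ _ → pathUp-AncestorChain) S∈pathUps)
    all-touching : All ConvexTouching (extras List.++ pathUps)
    all-touching = AllProperties.++⁺ extras-touching
      (AllProperties.tabulate⁺ λ i → pathUp-ConvexTouching (punchInᵢ≢i ρ i))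

  W-Γ-≥ : ∀ extras → Unique extras → All ConvexTouching extras → All (¬_ ∘ AncestorChain) extras →
    length extras + k + Γ G ρ ≤ W G ρ
  W-Γ-≥ extras extras! extras-touching extras-¬chain = begin
    length extras + k + Γ G ρ
      ≡⟨ +-comm (length extras + k) (Γ G ρ) ⟩
    Γ G ρ + (length extras + k)
      ≤⟨ +-monoʳ-≤ (Γ G ρ) (touching-≥ extras extras! extras-touching extras-¬chain) ⟩
    Γ G ρ + countSubsets (suc k) convexTouching?
      ≡⟨ sym W≡Γ+touching ⟩
    W G ρ ∎
    where open ≤-Reasoning

module TreeShape {k : ℕ} (G : Graph (suc k)) (tree : IsTree G) (ρ : Fin (suc k)) where
  open Paths G
  open RootedTree G tree ρ
  open TouchingSets G tree ρ

  module BranchSet {w c d} (w≢ρ : w ≢ ρ) (c≢d : c ≢ d) (cw : Child c w) (dw : Child d w) where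

    Member : Fin (suc k) → Set
    Member u = u ≢ ρ × (u ≼ w ⊎ u ≡ c ⊎ u ≡ d)

    member? : ∀ u → Dec (Member u)
    member? u = ¬? (u ≟ ρ) ×-dec ((u ∈ₗ? toRoot w) ⊎-dec (u ≟ c) ⊎-dec (u ≟ d))

    set : Subset (suc k)
    set = subsetOf member?

    member⁺ : ∀ {u} → Member u → u ∈ set
    member⁺ = ∈-subsetOf⁺ member?

    member⁻ : ∀ {u} → u ∈ set → Member u
    member⁻ = ∈-subsetOf⁻ member?

    c≢ρ : c ≢ ρ
    c≢ρ refl = ¬Child-ρ cw

    d≢ρ : d ≢ ρ
    d≢ρ refl = ¬Child-ρ dw

    closed : AncestorClosed set
    closed x∈ y≼x y≢ρ with member⁻ x∈
    ... | _ , inj₁ x≼w = member⁺ (y≢ρ , inj₁ (≼-trans y≼x x≼w))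
    ... | _ , inj₂ (inj₁ refl) = member⁺ (y≢ρ , [ inj₂ ∘ inj₁ , inj₁ ]′ (≼-Child cw y≼x))
    ... | _ , inj₂ (inj₂ refl) = member⁺ (y≢ρ , [ inj₂ ∘ inj₂ , inj₁ ]′ (≼-Child dw y≼x))

    root-neighbour⇒≼ : ∀ {x} → x ∈ set → Edge G ρ x → x ≼ w
    root-neighbour⇒≼ x∈ ρx with member⁻ x∈
    ... | _ , inj₁ x≼w = x≼w
    ... | _ , inj₂ (inj₁ refl) = ⊥-elim (w≢ρ (Child-parent-unique cw (Edge-ρ⇒Child (Edge-sym ρx))))
    ... | _ , inj₂ (inj₂ refl) = ⊥-elim (w≢ρ (Child-parent-unique dw (Edge-ρ⇒Child (Edge-sym ρx))))

    convexTouching : ConvexTouching set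
    convexTouching = (convex , λ ρ∈ → proj₁ (member⁻ ρ∈) refl) , meets
      where
      convex : IsP3Convex G set
      convex = convex-criterion set closed λ x∈ y∈ ρx ρy →
        ≼-depth-injective (root-neighbour⇒≼ x∈ ρx) (root-neighbour⇒≼ y∈ ρy)
          (trans (depth-neighbour-ρ ρx) (sym (depth-neighbour-ρ ρy)))
      meets : ¬ AvoidsNeighbours G ρ set
      meets avoids with root-neighbour-≼ w≢ρ
      ... | a , a≼w , aρ = avoids a (Edge-sym aρ) (member⁺ (Edge⇒≢ aρ , inj₁ a≼w))

    ¬ancestorChain : ¬ AncestorChain set
    ¬ancestorChain (_ , comparable)
      with comparable (member⁺ (c≢ρ , inj₂ (inj₁ refl))) (member⁺ (d≢ρ , inj₂ (inj₂ refl)))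
    ... | inj₁ c≼d = [ c≢d , Child⇒⋡ cw ]′ (≼-Child dw c≼d)
    ... | inj₂ d≼c = [ c≢d ∘ sym , Child⇒⋡ dw ]′ (≼-Child cw d≼c)

  -- {a, x} is convex because a and x are at distance at least 3.
  module StrayPairSet {a x} (aρ : Edge G a ρ) (3≤x : 3 ≤ depth x) (a⋠x : ¬ a ≼ x) where

    Member : Fin (suc k) → Set
    Member u = u ≡ a ⊎ u ≡ x

    member? : ∀ u → Dec (Member u)
    member? u = (u ≟ a) ⊎-dec (u ≟ x)

    set : Subset (suc k)
    set = subsetOf member?

    x≢ρ : x ≢ ρ
    x≢ρ = depth≥2⇒≢ρ (≤-trans (s≤s (s≤s z≤n)) 3≤x)

    parentOfX : ∃ λ p → Edge G x p × Child x p
    parentOfX = parent x≢ρ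

    p : Fin (suc k)
    p = proj₁ parentOfX

    xp : Child x p
    xp = proj₂ (proj₂ parentOfX)

    p≢ρ : p ≢ ρ
    p≢ρ = depth≥2⇒≢ρ (≤-pred (subst (3 ≤_) (Child-depth xp) 3≤x))

    p≢a : p ≢ a
    p≢a refl = a⋠x (Child⇒≼ xp)

    no-common-neighbour : ∀ {z} → Edge G a z → Edge G z x → ⊥
    no-common-neighbour az zx with Edge⇒Child az | Edge⇒Child zx
    ... | inj₂ za | inj₁ zx-child = a⋠x (subst (_≼ x) (Child-parent-unique zx-child za) ≼-refl)
    ... | inj₂ za | inj₂ xz = a⋠x (≼-trans (Child⇒≼ za) (Child⇒≼ xz))
    ... | inj₁ az-child | inj₁ zx-child
      with Child-parent-unique az-child (Edge-ρ⇒Child aρ)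
    ...   | refl = ¬Child-ρ zx-child
    no-common-neighbour az zx | inj₁ az-child | inj₂ xz
      with Child-parent-unique az-child (Edge-ρ⇒Child aρ) | Child-parent-unique xz xp
    ...   | refl | z≡p = p≢ρ (sym z≡p)

    convexTouching : ConvexTouching set
    convexTouching = (convex , ρ∉) , λ avoids → avoids a (Edge-sym aρ) (∈-subsetOf⁺ member? (inj₁ refl))
      where
      convex : IsP3Convex G set
      convex u z v u≢v uz zv u∈ v∈ with ∈-subsetOf⁻ member? u∈ | ∈-subsetOf⁻ member? v∈
      ... | inj₁ refl | inj₁ refl = ⊥-elim (u≢v refl)
      ... | inj₂ refl | inj₂ refl = ⊥-elim (u≢v refl)
      ... | inj₁ refl | inj₂ refl = ⊥-elim (no-common-neighbour uz zv)
      ... | inj₂ refl | inj₁ refl = ⊥-elim (no-common-neighbour (Edge-sym zv) (Edge-sym uz))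
      ρ∉ : ¬ ρ ∈ set
      ρ∉ ρ∈ = [ Edge⇒≢ aρ ∘ sym , x≢ρ ∘ sym ]′ (∈-subsetOf⁻ member? ρ∈)

    ¬ancestorChain : ¬ AncestorChain set
    ¬ancestorChain (closed , _)
      with ∈-subsetOf⁻ member? (closed (∈-subsetOf⁺ member? (inj₂ refl)) (Child⇒≼ xp) p≢ρ)
    ... | inj₁ p≡a = p≢a p≡a
    ... | inj₂ p≡x = Child⇒⋡ xp (subst (_≼ p) p≡x ≼-refl)

  TwoChildren : Set
  TwoChildren = ∃ λ w → ∃ λ c → ∃ λ d → w ≢ ρ × c ≢ d × Child c w × Child d w

  child? : ∀ c p → Dec (Child c p)
  child? c p = ≡-dec _≟_ (toRoot c) (c ∷ toRoot p)

  twoChildren? : Dec TwoChildren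
  twoChildren? = any? λ w → any? λ c → any? λ d →
    ¬? (w ≟ ρ) ×-dec ¬? (c ≟ d) ×-dec child? c w ×-dec child? d w

  StrayNeighbour : Set
  StrayNeighbour = ∃ λ a → ∃ λ x → Edge G a ρ × 3 ≤ depth x × ¬ a ≼ x

  strayNeighbour? : Dec StrayNeighbour
  strayNeighbour? = any? λ a → any? λ x →
    T? (adj G a ρ) ×-dec 3 ≤? depth x ×-dec ¬? (a ∈ₗ? toRoot x)

  UniqueAtDepth : ℕ → Set
  UniqueAtDepth d = ∀ {u v} → depth u ≡ d → depth v ≡ d → u ≡ v

  parent-at-depth : ∀ {u d} → depth u ≡ suc (suc d) → ∃ λ p → Child u p × depth p ≡ suc d
  parent-at-depth du with parent (depth≥2⇒≢ρ (subst (2 ≤_) (sym du) (s≤s (s≤s z≤n))))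
  ... | p , _ , up = p , up , suc-injective (trans (sym (Child-depth up)) du)

  unique-at-depth-suc : ¬ TwoChildren → ∀ d → UniqueAtDepth (suc (suc d)) → UniqueAtDepth (suc (suc (suc d)))
  unique-at-depth-suc ¬two d unique {u} {v} du dv with u ≟ v | parent-at-depth du | parent-at-depth dv
  ... | yes u≡v | _ | _ = u≡v
  ... | no u≢v | p , up , dp | _ , vq , dq with unique dp dq
  ...   | refl = ⊥-elim (¬two (p , u , v , depth≥2⇒≢ρ (subst (2 ≤_) (sym dp) (s≤s (s≤s z≤n))) , u≢v , up , vq))

  depth-injective : ¬ TwoChildren → UniqueAtDepth 2 → DepthInjective
  depth-injective ¬two unique₂ {u} du≡dv = unique-at (depth u) refl (sym du≡dv)
    where
    unique-at : ∀ d → UniqueAtDepth d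
    unique-at zero {u} du _ with subst (1 ≤_) du (depth≥1 u)
    ... | ()
    unique-at (suc zero) du dv = trans (depth≡1⇒ρ du) (sym (depth≡1⇒ρ dv))
    unique-at (suc (suc zero)) = unique₂
    unique-at (suc (suc (suc d))) = unique-at-depth-suc ¬two d (unique-at (suc (suc d)))

  unique-at-depth-2 : ¬ StrayNeighbour → ∀ {x} → 3 ≤ depth x → UniqueAtDepth 2
  unique-at-depth-2 ¬stray {x} 3≤x du dv = ≼-depth-injective (on-path du) (on-path dv) (trans du (sym dv))
    where
    on-path : ∀ {u} → depth u ≡ 2 → u ≼ x
    on-path {u} du with u ∈ₗ? toRoot x
    ... | yes u≼x = u≼x
    ... | no u⋠x = ⊥-elim (¬stray (u , x , depth≡2⇒Edge-ρ du , 3≤x , u⋠x))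

  data Shape : Set where
    extra : ∀ S → ConvexTouching S → ¬ AncestorChain S → Shape
    starlike : (∀ v → depth v ≤ 2) → Shape
    pathlike : DepthInjective → Shape

  shape : Shape
  shape with twoChildren?
  ... | yes (_ , _ , _ , w≢ρ , c≢d , cw , dw) =
    let open BranchSet w≢ρ c≢d cw dw in extra set convexTouching ¬ancestorChain
  ... | no ¬two with strayNeighbour?
  ...   | yes (_ , _ , aρ , 3≤x , a⋠x) =
    let open StrayPairSet aρ 3≤x a⋠x in extra set convexTouching ¬ancestorChain
  ...   | no ¬stray with any? (λ x → 3 ≤? depth x)
  ...     | yes (_ , 3≤x) = pathlike (depth-injective ¬two (unique-at-depth-2 ¬stray 3≤x))
  ...     | no ¬deep = starlike λ v → ≤-pred (≰⇒> λ 3≤v → ¬deep (v , 3≤v))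

-- Recognising stars and paths

T-injective : ∀ {a b} → (T a → T b) → (T b → T a) → a ≡ b
T-injective {true} {true} _ _ = refl
T-injective {true} {false} f _ = ⊥-elim (f _)
T-injective {false} {true} _ g = ⊥-elim (g _)
T-injective {false} {false} _ _ = refl

injective⇒surjective : ∀ {N} (f : Fin N → Fin N) → Injective _≡_ _≡_ f → ∀ y → ∃ λ x → f x ≡ y
injective⇒surjective {suc N} f f-inj y with any? (λ x → f x ≟ y)
... | yes hit = hit
... | no miss = ⊥-elim (<-irrefl refl (injective⇒≤ {f = f′} f′-inj))
  where
  f′ : Fin (suc N) → Fin N
  f′ x = punchOut {i = y} {j = f x} (λ y≡fx → miss (x , sym y≡fx))
  f′-inj : Injective _≡_ _≡_ f′
  f′-inj {x} {x′} eq = f-inj (punchOut-injective (λ e → miss (x , sym e)) (λ e → miss (x′ , sym e)) eq)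

injective⇒permutation : ∀ {N} (f : Fin N → Fin N) → Injective _≡_ _≡_ f → Permutation′ N
injective⇒permutation f f-inj =
  permutation f (λ y → proj₁ (surj y)) (λ y → proj₂ (surj y)) (λ x → f-inj (proj₂ (surj (f x))))
  where
  surj : ∀ y → ∃ λ x → f x ≡ y
  surj = injective⇒surjective f f-inj

isZero-≢zero : ∀ {N} {i : Fin (suc N)} → i ≢ zero → isZero i ≡ false
isZero-≢zero {i = zero} i≢0 = ⊥-elim (i≢0 refl)
isZero-≢zero {i = suc _} _ = refl

isZero-transpose : ∀ {N} (c u : Fin (suc N)) → isZero (PC.transpose c zero u) ≡ does (u ≟ c)
isZero-transpose c u with u ≟ c
... | yes _ = refl
... | no u≢c with u ≟ zero
...   | yes refl = isZero-≢zero λ c≡0 → u≢c (sym c≡0)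
...   | no u≢0 = isZero-≢zero u≢0

module StarIso {N : ℕ} (G : Graph (suc N)) (tree : IsTree G) (c : Fin (suc N))
               (shallow : ∀ v → RootedTree.depth G tree c v ≤ 2) where
  open Paths G
  open RootedTree G tree c

  Edge-centre : ∀ {v} → v ≢ c → Edge G v c
  Edge-centre v≢c with parent v≢c
  ... | p , vp-edge , vp with depth≡1⇒ρ {p} (≤-antisym (≤-pred (subst (_≤ 2) (Child-depth vp) (shallow _))) (depth≥1 p))
  ...   | refl = vp-edge

  only-centre-has-children : ∀ {x p} → p ≢ c → ¬ Child x p
  only-centre-has-children {x} p≢c xp with ≤-trans (s≤s (depth≥2 p≢c)) (subst (_≤ 2) (Child-depth xp) (shallow x))
  ... | s≤s (s≤s ())

  adj-centre : ∀ u v → adj G u v ≡ does (u ≟ c) xor does (v ≟ c)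
  adj-centre u v with u ≟ c | v ≟ c
  ... | yes refl | yes refl = Graph.irrefl G c
  ... | yes refl | no v≢c = T-injective (λ _ → _) (λ _ → Edge-sym (Edge-centre v≢c))
  ... | no u≢c | yes refl = T-injective (λ _ → _) (λ _ → Edge-centre u≢c)
  ... | no u≢c | no v≢c = T-injective
    (λ e → [ only-centre-has-children v≢c , only-centre-has-children u≢c ]′ (Edge⇒Child e)) (λ ())

  star-≅ : G ≅ star (suc N)
  star-≅ = transpose c zero , λ u v →
    trans (adj-centre u v) (sym (cong₂ _xor_ (isZero-transpose c u) (isZero-transpose c v)))

module PathIso {N : ℕ} (G : Graph N) (tree : IsTree G) (c : Fin N)
               (depth-injective : RootedTree.DepthInjective G tree c) where
  open Paths G
  open RootedTree G tree c

  depth≤N : ∀ v → depth v ≤ N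
  depth≤N v = ≤-trans (Unique⇒length≤ (SimplePath⇒Unique (toRoot-path v)) (λ {x} _ → ∈-allFin x))
                      (≤-reflexive (length-tabulate (λ x → x)))

  suc-pred-depth : ∀ v → suc (pred (depth v)) ≡ depth v
  suc-pred-depth v = suc-pred (depth v) {{>-nonZero (depth≥1 v)}}

  level : Fin N → Fin N
  level v = fromℕ< (subst (_≤ N) (sym (suc-pred-depth v)) (depth≤N v))

  suc-level : ∀ v → suc (toℕ (level v)) ≡ depth v
  suc-level v = trans (cong suc (toℕ-fromℕ< _)) (suc-pred-depth v)

  level-injective : Injective _≡_ _≡_ level
  level-injective {u} {v} eq =
    depth-injective (trans (sym (suc-level u)) (trans (cong (λ i → suc (toℕ i)) eq) (suc-level v)))

  Child⇒next-level : ∀ {u p} → Child u p → suc (toℕ (level p)) ≡ toℕ (level u)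
  Child⇒next-level {u} {p} up =
    suc-injective (trans (cong suc (suc-level p)) (trans (sym (Child-depth up)) (sym (suc-level u))))

  next-level⇒depth : ∀ {u v} → suc (toℕ (level u)) ≡ toℕ (level v) → depth v ≡ suc (depth u)
  next-level⇒depth {u} {v} eq = trans (sym (suc-level v)) (trans (cong suc (sym eq)) (cong suc (suc-level u)))

  next-level⇒Edge : ∀ {u v} → suc (toℕ (level u)) ≡ toℕ (level v) → Edge G v u
  next-level⇒Edge {u} {v} eq with parent (depth≥2⇒≢ρ (subst (2 ≤_) (sym (next-level⇒depth eq)) (s≤s (depth≥1 u))))
  ... | p , vp-edge , vp with depth-injective {p} {u} (suc-injective (trans (sym (Child-depth vp)) (next-level⇒depth eq)))
  ...   | refl = vp-edge

  path-≅ : G ≅ pathGraph N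
  path-≅ = injective⇒permutation level level-injective , λ u v → T-injective (to u v) (from u v)
    where
    to : ∀ u v → Edge G u v → T (adj (pathGraph N) (level u) (level v))
    to u v e with Edge⇒Child e
    ... | inj₁ uv = Equivalence.from T-∨ (inj₂ (≡⇒≡ᵇ _ _ (Child⇒next-level uv)))
    ... | inj₂ vu = Equivalence.from T-∨ (inj₁ (≡⇒≡ᵇ _ _ (Child⇒next-level vu)))
    from : ∀ u v → T (adj (pathGraph N) (level u) (level v)) → Edge G u v
    from u v t with Equivalence.to T-∨ t
    ... | inj₁ up = Edge-sym (next-level⇒Edge (≡ᵇ⇒≡ _ _ up))
    ... | inj₂ down = next-level⇒Edge (≡ᵇ⇒≡ _ _ down)

-- Deleting a pendant vertex

module _ {m : ℕ} (S : Subset m) (r : Fin (suc m)) where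

  insertAt-∈-pivot : r ∈ insertAt S r true
  insertAt-∈-pivot = lookup⇒[]= r _ (insertAt-lookup S r true)

  insertAt-∉-pivot : r ∉ insertAt S r false
  insertAt-∉-pivot r∈ with trans (sym (insertAt-lookup S r false)) ([]=⇒lookup r∈)
  ... | ()

  insertAt-∈-punchIn⁺ : ∀ {b j} → j ∈ S → punchIn r j ∈ insertAt S r b
  insertAt-∈-punchIn⁺ {b} {j} j∈ = lookup⇒[]= (punchIn r j) _ (trans (insertAt-punchIn S r b j) ([]=⇒lookup j∈))

  insertAt-∈-punchIn⁻ : ∀ {b j} → punchIn r j ∈ insertAt S r b → j ∈ S
  insertAt-∈-punchIn⁻ {b} {j} j∈ = lookup⇒[]= j S (trans (sym (insertAt-punchIn S r b j)) ([]=⇒lookup j∈))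

vertex-split : ∀ {m} (r x : Fin (suc m)) → x ≡ r ⊎ ∃ λ v → x ≡ punchIn r v
vertex-split r x with r ≟ x
... | yes r≡x = inj₁ (sym r≡x)
... | no r≢x = inj₂ (punchOut r≢x , sym (punchIn-punchOut r≢x))

Pendant : ∀ {m} → Graph (suc m) → Fin (suc m) → Fin m → Set
Pendant G r r′ = Edge G r (punchIn r r′) × (∀ x → Edge G r x → x ≡ punchIn r r′)

module PendantVertex {m : ℕ} (G : Graph (suc m)) (r : Fin (suc m)) (r′ : Fin m) (pendant : Pendant G r r′) where
  open Paths G using (Edge-sym)

  r-edge : Edge G r (punchIn r r′)
  r-edge = proj₁ pendant

  r-only-neighbour : ∀ x → Edge G r x → x ≡ punchIn r r′
  r-only-neighbour = proj₂ pendant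

  G′ : Graph m
  G′ = deleteVertex G r

  r-never-middle : ∀ {x y} → x ≢ y → Edge G x r → Edge G r y → ⊥
  r-never-middle x≢y xr ry = x≢y (trans (r-only-neighbour _ (Edge-sym xr)) (sym (r-only-neighbour _ ry)))

  restrict-convex : ∀ {b} S → IsP3Convex G (insertAt S r b) → IsP3Convex G′ S
  restrict-convex S convex x z y x≢y xz zy x∈ y∈ = insertAt-∈-punchIn⁻ S r
    (convex (punchIn r x) (punchIn r z) (punchIn r y) (λ eq → x≢y (punchIn-injective r x y eq)) xz zy
            (insertAt-∈-punchIn⁺ S r x∈) (insertAt-∈-punchIn⁺ S r y∈))

  private
    lifted-middle : ∀ {b} S → IsP3Convex G′ S → ∀ x z y → punchIn r x ≢ punchIn r y →
      Edge G (punchIn r x) (punchIn r z) → Edge G (punchIn r z) (punchIn r y) →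
      punchIn r x ∈ insertAt S r b → punchIn r y ∈ insertAt S r b → punchIn r z ∈ insertAt S r b
    lifted-middle S convex x z y x≢y xz zy x∈ y∈ = insertAt-∈-punchIn⁺ S r
      (convex x z y (λ eq → x≢y (cong (punchIn r) eq)) xz zy (insertAt-∈-punchIn⁻ S r x∈) (insertAt-∈-punchIn⁻ S r y∈))

  extend-convex-false : ∀ S → IsP3Convex G′ S → IsP3Convex G (insertAt S r false)
  extend-convex-false S convex x z y x≢y xz zy x∈ y∈
    with vertex-split r x | vertex-split r y | vertex-split r z
  ... | inj₁ refl | _ | _ = ⊥-elim (insertAt-∉-pivot S r x∈)
  ... | inj₂ _ | inj₁ refl | _ = ⊥-elim (insertAt-∉-pivot S r y∈)
  ... | inj₂ _ | inj₂ _ | inj₁ refl = ⊥-elim (r-never-middle x≢y xz zy)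
  ... | inj₂ (x′ , refl) | inj₂ (y′ , refl) | inj₂ (z′ , refl) = lifted-middle S convex x′ z′ y′ x≢y xz zy x∈ y∈

  convex-true⇒avoids : ∀ S → IsP3Convex G (insertAt S r true) → r′ ∉ S → AvoidsNeighbours G′ r′ S
  convex-true⇒avoids S convex r′∉ u r′u u∈ = r′∉ (insertAt-∈-punchIn⁻ S r
    (convex r (punchIn r r′) (punchIn r u) (λ r≡u → punchInᵢ≢i r u (sym r≡u)) r-edge r′u
            (insertAt-∈-pivot S r) (insertAt-∈-punchIn⁺ S r u∈)))

  private
    r-neighbour-∈ : ∀ S → r′ ∈ S ⊎ AvoidsNeighbours G′ r′ S → ∀ {z y} →
      Edge G r (punchIn r z) → Edge G′ z y → y ∈ S → punchIn r z ∈ insertAt S r true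
    r-neighbour-∈ S r′∈-or-avoids {z} {y} rz zy y∈ with punchIn-injective r z r′ (r-only-neighbour _ rz)
    ... | refl with r′∈-or-avoids
    ...   | inj₁ r′∈ = insertAt-∈-punchIn⁺ S r r′∈
    ...   | inj₂ avoids = ⊥-elim (avoids y zy y∈)

  extend-convex-true : ∀ S → IsP3Convex G′ S → r′ ∈ S ⊎ AvoidsNeighbours G′ r′ S →
    IsP3Convex G (insertAt S r true)
  extend-convex-true S convex r′∈-or-avoids x z y x≢y xz zy x∈ y∈
    with vertex-split r x | vertex-split r y | vertex-split r z
  ... | _ | _ | inj₁ refl = ⊥-elim (r-never-middle x≢y xz zy)
  ... | inj₁ refl | inj₁ refl | _ = ⊥-elim (x≢y refl)
  ... | inj₁ refl | inj₂ (y′ , refl) | inj₂ (z′ , refl) =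
    r-neighbour-∈ S r′∈-or-avoids xz zy (insertAt-∈-punchIn⁻ S r y∈)
  ... | inj₂ (x′ , refl) | inj₁ refl | inj₂ (z′ , refl) =
    r-neighbour-∈ S r′∈-or-avoids (Edge-sym zy) (Edge-sym xz) (insertAt-∈-punchIn⁻ S r x∈)
  ... | inj₂ (x′ , refl) | inj₂ (y′ , refl) | inj₂ (z′ , refl) = lifted-middle S convex x′ z′ y′ x≢y xz zy x∈ y∈

  noc-without-r : countSubsets m (λ S → isP3Convex? G (insertAt S r false)) ≡ noc G′
  noc-without-r = countSubsets-cong m _ _ ((λ {S} → restrict-convex S) , λ {S} → extend-convex-false S)

  noc-with-r : countSubsets m (λ S → isP3Convex? G (insertAt S r true)) ≡
               countSubsets m (λ S → isP3Convex? G′ S ×-dec (r′ ∈? S)) + Γ G′ r′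
  noc-with-r = trans (countSubsets-split m _ (r′ ∈?_))
    (cong₂ _+_ (countSubsets-cong m _ _ ( (λ {S} (c , r′∈) → restrict-convex S c , r′∈)
                                        , (λ {S} (c , r′∈) → extend-convex-true S c (inj₁ r′∈) , r′∈)))
               (countSubsets-cong m _ _ ( (λ {S} (c , r′∉) → restrict-convex S c , r′∉ , convex-true⇒avoids S c r′∉)
                                        , (λ {S} (c , r′∉ , avoids) → extend-convex-true S c (inj₂ avoids) , r′∉))))

  -- A convex set of G without r is just a convex set of G′, as r is never the middle of a P₃;
  -- with r, its trace on G′ must in addition contain r′ or avoid all neighbours of r′.
  noc+W≡2noc+Γ : noc G + W G′ r′ ≡ noc G′ + noc G′ + Γ G′ r′
  noc+W≡2noc+Γ = begin
    noc G + W G′ r′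
      ≡⟨ cong (_+ W G′ r′) (countSubsets-insertAt m r (isP3Convex? G)) ⟩
    (countSubsets m (λ S → isP3Convex? G (insertAt S r false)) +
     countSubsets m (λ S → isP3Convex? G (insertAt S r true))) + W G′ r′
      ≡⟨ cong (_+ W G′ r′) (cong₂ _+_ noc-without-r noc-with-r) ⟩
    (noc G′ + (containing-r′ + Γ G′ r′)) + W G′ r′
      ≡⟨ rearrange (noc G′) containing-r′ (Γ G′ r′) (W G′ r′) ⟩
    noc G′ + (containing-r′ + W G′ r′) + Γ G′ r′
      ≡⟨ cong (λ t → noc G′ + t + Γ G′ r′) (sym (countSubsets-split m (isP3Convex? G′) (r′ ∈?_))) ⟩
    noc G′ + noc G′ + Γ G′ r′ ∎
    where
    open ≡-Reasoning
    containing-r′ : ℕ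
    containing-r′ = countSubsets m (λ S → isP3Convex? G′ S ×-dec (r′ ∈? S))
    rearrange : ∀ a b c d → (a + (b + c)) + d ≡ a + (b + d) + c
    rearrange = solve-∀

  noc+t≤2noc : ∀ {t} → t + Γ G′ r′ ≤ W G′ r′ → noc G + t ≤ noc G′ + noc G′
  noc+t≤2noc {t} t+Γ≤W = +-cancelʳ-≤ (Γ G′ r′) (noc G + t) (noc G′ + noc G′) (begin
    noc G + t + Γ G′ r′    ≡⟨ +-assoc (noc G) t (Γ G′ r′) ⟩
    noc G + (t + Γ G′ r′)  ≤⟨ +-monoʳ-≤ (noc G) t+Γ≤W ⟩
    noc G + W G′ r′        ≡⟨ noc+W≡2noc+Γ ⟩
    noc G′ + noc G′ + Γ G′ r′ ∎)
    where open ≤-Reasoning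

module PendantVertexOfTree {m : ℕ} (G : Graph (suc m)) (tree : IsTree G) (r : Fin (suc m)) (r′ : Fin m)
                           (pendant : Pendant G r r′) where
  open Paths G
  open PendantVertex G r r′ pendant public

  ρ̂ : Fin (suc m)
  ρ̂ = punchIn r r′

  acyclic′ : ¬ HasCycle G′
  acyclic′ (x , ys , 2≤len , ys! , linked) = proj₂ tree
    ( punchIn r x , map (punchIn r) ys
    , subst (2 ≤_) (sym (length-map (punchIn r) ys)) 2≤len
    , UniqueProperties.map⁺ (punchIn-injective r _ _) ys!
    , subst (Linked (Edge G)) (map-++ (punchIn r) (x ∷ ys) (x ∷ [])) (LinkedProperties.map⁺ linked))

  private
    avoids-r : ∀ {x vs} → SimplePath x ρ̂ vs → x ≢ r → r ∉ₗ vs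
    avoids-r single x≢r (here r≡x) = x≢r (sym r≡x)
    avoids-r (extend _ _ _) x≢r (here r≡x) = x≢r (sym r≡x)
    avoids-r {x} (extend {w = w} e x∉ p) x≢r (there r∈) with w ≟ r
    ... | yes refl = x∉ (subst (_∈ₗ _) (sym (r-only-neighbour x (Edge-sym e))) (SimplePath-end p))
    ... | no w≢r = avoids-r p w≢r r∈

    toWalk′ : ∀ {a b} → WalkWithin (_≢ r) a b →
      ∀ a′ b′ → a ≡ punchIn r a′ → b ≡ punchIn r b′ → Walk G′ a′ b′
    toWalk′ (stay _) a′ b′ refl eq = subst (Walk G′ a′) (punchIn-injective r a′ b′ eq) here
    toWalk′ (hop {w = w} _ e p) a′ b′ refl refl =
      step (subst (λ z → Edge G (punchIn r a′) z) (sym (punchIn-punchOut r≢w)) e)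
           (toWalk′ p (punchOut r≢w) b′ (sym (punchIn-punchOut r≢w)) refl)
      where
      r≢w : r ≢ w
      r≢w r≡w = WalkWithin-start p (sym r≡w)

    open RootedTree G tree ρ̂ using (toRoot-path)

    toρ̂ : ∀ v → WalkWithin (_≢ r) (punchIn r v) ρ̂
    toρ̂ v = SimplePath⇒WalkWithin (toRoot-path _)
      (¬Any⇒All¬ _ λ r∈ → avoids-r (toRoot-path _) (punchInᵢ≢i r v) (Any.map sym r∈))

  connected′ : ∀ u v → Walk G′ u v
  connected′ u v = toWalk′ (toρ̂ u ++ʷ reverseʷ (toρ̂ v)) u v refl refl

  tree′ : IsTree G′
  tree′ = connected′ , acyclic′

  module P′ = Paths G′
  module R′ = RootedTree G′ tree′ r′
  module Rρ̂ = RootedTree G tree ρ̂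
  module Rr = RootedTree G tree r

  private
    ∉-map : ∀ {u vs} → u ∉ₗ vs → punchIn r u ∉ₗ map (punchIn r) vs
    ∉-map u∉ pu∈ with ∈-map⁻ (punchIn r) pu∈
    ... | _ , y∈ , eq = u∉ (subst (_∈ₗ _) (sym (punchIn-injective r _ _ eq)) y∈)

    lift : ∀ {v vs} → P′.SimplePath v r′ vs → SimplePath (punchIn r v) ρ̂ (map (punchIn r) vs)
    lift P′.single = single
    lift (P′.extend e v∉ p) = extend e (∉-map v∉) (lift p)

    lift-to-r : ∀ {v vs} → P′.SimplePath v r′ vs → SimplePath (punchIn r v) r (map (punchIn r) vs ∷ʳ r)
    lift-to-r P′.single = extend (Edge-sym r-edge) (λ { (here r̂≡r) → punchInᵢ≢i r r′ r̂≡r }) single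
    lift-to-r {v} (P′.extend {vs = vs} e v∉ p) = extend e v∉′ (lift-to-r p)
      where
      v∉′ : punchIn r v ∉ₗ map (punchIn r) vs ∷ʳ r
      v∉′ v∈ with ∈-++⁻ (map (punchIn r) vs) v∈
      ... | inj₁ v∈vs = ∉-map v∉ v∈vs
      ... | inj₂ (here v≡r) = punchInᵢ≢i r v v≡r

  depth-lift-ρ̂ : ∀ v → Rρ̂.depth (punchIn r v) ≡ R′.depth v
  depth-lift-ρ̂ v = trans (cong length (sym (Rρ̂.toRoot-unique (lift (R′.toRoot-path v)))))
                         (length-map (punchIn r) (R′.toRoot v))

  depth-lift-r : ∀ v → Rr.depth (punchIn r v) ≡ suc (R′.depth v)
  depth-lift-r v = trans (cong length (sym (Rr.toRoot-unique (lift-to-r (R′.toRoot-path v)))))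
    (trans (length-++ (map (punchIn r) (R′.toRoot v)))
    (trans (+-comm (length (map (punchIn r) (R′.toRoot v))) 1)
           (cong suc (length-map (punchIn r) (R′.toRoot v)))))

  shallow-lift : (∀ v → R′.depth v ≤ 2) → ∀ x → Rρ̂.depth x ≤ 2
  shallow-lift shallow x with vertex-split r x
  ... | inj₁ refl = ≤-reflexive (Rρ̂.depth-neighbour-ρ (Edge-sym r-edge))
  ... | inj₂ (v , refl) = subst (_≤ 2) (sym (depth-lift-ρ̂ v)) (shallow v)

  r-not-lifted : ∀ v → suc (R′.depth v) ≢ Rr.depth r
  r-not-lifted v eq with subst (2 ≤_) (trans eq Rr.depth-ρ) (s≤s (R′.depth≥1 v))
  ... | s≤s ()

  injective-lift : R′.DepthInjective → Rr.DepthInjective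
  injective-lift injective {x} {y} eq with vertex-split r x | vertex-split r y
  ... | inj₁ refl | inj₁ refl = refl
  ... | inj₁ refl | inj₂ (v , refl) = ⊥-elim (r-not-lifted v (trans (sym (depth-lift-r v)) (sym eq)))
  ... | inj₂ (u , refl) | inj₁ refl = ⊥-elim (r-not-lifted u (trans (sym (depth-lift-r u)) eq))
  ... | inj₂ (u , refl) | inj₂ (v , refl) =
    cong (punchIn r) (injective (suc-injective (trans (sym (depth-lift-r u)) (trans eq (depth-lift-r v)))))

-- Convex sets of the star

AtMostOne : ∀ {m} → Pred (Subset m) 0ℓ
AtMostOne {m} S = ∀ (i j : Fin m) → i ∈ S → j ∈ S → i ≡ j

atMostOne? : ∀ {m} → Decidable (AtMostOne {m})
atMostOne? S = all? λ i → all? λ j → i ∈? S →-dec j ∈? S →-dec i ≟ j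

countSubsets-Empty : ∀ m → countSubsets m (λ S → ¬? (nonempty? S)) ≡ 1
countSubsets-Empty zero with nonempty? []
... | yes (() , _)
... | no _ = refl
countSubsets-Empty (suc m) = trans (countSubsets-suc m _) (cong₂ _+_
  (trans (countSubsets-cong m _ _ (drop-∷-Empty , λ { e (suc i , there i∈) → e (i , i∈) })) (countSubsets-Empty m))
  (countSubsets-none m _ λ S e → e (zero , here)))

countSubsets-AtMostOne : ∀ m → countSubsets m atMostOne? ≡ suc m
countSubsets-AtMostOne zero with atMostOne? []
... | yes _ = refl
... | no ¬amo = ⊥-elim (¬amo λ ())
countSubsets-AtMostOne (suc m) = trans (countSubsets-suc m atMostOne?) (trans (cong₂ _+_
  (trans (countSubsets-cong m _ atMostOne? (drop-outside , add-outside)) (countSubsets-AtMostOne m))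
  (trans (countSubsets-cong m _ _ (inside⇒Empty , Empty⇒inside)) (countSubsets-Empty m)))
  (+-comm (suc m) 1))
  where
  drop-outside : ∀ {S} → AtMostOne (false ∷ S) → AtMostOne S
  drop-outside amo i j i∈ j∈ = Fin.suc-injective (amo (suc i) (suc j) (there i∈) (there j∈))
  add-outside : ∀ {S} → AtMostOne S → AtMostOne (false ∷ S)
  add-outside amo (suc i) (suc j) (there i∈) (there j∈) = cong suc (amo i j i∈ j∈)
  inside⇒Empty : ∀ {S} → AtMostOne (true ∷ S) → Empty S
  inside⇒Empty amo (i , i∈) with amo zero (suc i) here (there i∈)
  ... | ()
  Empty⇒inside : ∀ {S} → Empty S → AtMostOne (true ∷ S)
  Empty⇒inside e zero zero _ _ = refl
  Empty⇒inside e zero (suc j) _ (there j∈) = ⊥-elim (e (j , j∈))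
  Empty⇒inside e (suc i) _ (there i∈) _ = ⊥-elim (e (i , i∈))

module _ {m : ℕ} where

  star-convex-inside : ∀ S → IsP3Convex (star (suc m)) (true ∷ S)
  star-convex-inside S _ zero _ _ _ _ _ _ = here
  star-convex-inside S zero (suc _) zero x≢y _ _ _ _ = ⊥-elim (x≢y refl)
  star-convex-inside S zero (suc _) (suc _) _ _ () _ _
  star-convex-inside S (suc _) (suc _) _ _ () _ _ _

  star-convex-outside⁻ : ∀ {S} → IsP3Convex (star (suc m)) (false ∷ S) → AtMostOne S
  star-convex-outside⁻ convex i j i∈ j∈ with i ≟ j
  ... | yes i≡j = i≡j
  ... | no i≢j with convex (suc i) zero (suc j) (λ eq → i≢j (Fin.suc-injective eq)) _ _ (there i∈) (there j∈)
  ...   | ()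

  star-convex-outside⁺ : ∀ {S} → AtMostOne S → IsP3Convex (star (suc m)) (false ∷ S)
  star-convex-outside⁺ amo zero _ _ _ _ _ () _
  star-convex-outside⁺ amo (suc _) zero zero _ _ _ _ ()
  star-convex-outside⁺ amo (suc x) zero (suc y) x≢y _ _ (there x∈) (there y∈) = ⊥-elim (x≢y (cong suc (amo x y x∈ y∈)))
  star-convex-outside⁺ amo (suc _) (suc _) _ _ () _ _ _

noc-star : ∀ m → noc (star (suc m)) ≡ 2 ^ m + suc m
noc-star m = trans (countSubsets-suc m (isP3Convex? (star (suc m)))) (trans (cong₂ _+_
  (trans (countSubsets-cong m _ atMostOne? (star-convex-outside⁻ , star-convex-outside⁺)) (countSubsets-AtMostOne m))
  (countSubsets-all m _ star-convex-inside))
  (+-comm (suc m) (2 ^ m)))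

-- The bound on noc

leaf-neighbour-unique : ∀ {n} (G : Graph n) {r a b} → IsLeaf G r → Edge G r a → Edge G r b → a ≡ b
leaf-neighbour-unique {n} G {r} {a} {b} leaf ra rb with a ≟ b
... | yes a≡b = a≡b
... | no a≢b = ⊥-elim (1+n≰n (subst (2 ≤_) leaf (Unique⇒length≤ ((a≢b ∷ []) ∷ [] ∷ []) neighbours)))
  where
  neighbours : ∀ {x} → x ∈ₗ a ∷ b ∷ [] → x ∈ₗ filter (λ u → T? (adj G r u)) (allFin n)
  neighbours (here refl) = ∈-filter⁺ _ (∈-allFin a) ra
  neighbours (there (here refl)) = ∈-filter⁺ _ (∈-allFin b) rb

unique-neighbour⇒Pendant : ∀ {m} (G : Graph (suc m)) {r} →
  (∃ λ p → Edge G r p × (∀ u → Edge G r u → u ≡ p)) → ∃ (Pendant G r)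
unique-neighbour⇒Pendant G {r} (p , rp , only) = punchOut r≢p , subst (Edge G r) (sym (punchIn-punchOut r≢p)) rp ,
  λ u e → trans (only u e) (sym (punchIn-punchOut r≢p))
  where
  r≢p : r ≢ p
  r≢p = Paths.Edge⇒≢ G rp

module _ {k : ℕ} (G : Graph (suc (suc k))) (tree : IsTree G) where
  open RootedTree G tree zero

  deepest : Fin (suc (suc k))
  deepest = argmax depth zero (allFin _)

  depth≤deepest : ∀ u → depth u ≤ depth deepest
  depth≤deepest u = All.lookup (f[xs]≤f[argmax] {f = depth} zero (allFin _)) (∈-allFin u)

  deepest≢root : deepest ≢ zero
  deepest≢root = depth≥2⇒≢ρ (≤-trans (depth≥2 {suc zero} λ ()) (depth≤deepest (suc zero)))

  leaf-exists : ∃ λ r → ∃ (Pendant G r)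
  leaf-exists = deepest , unique-neighbour⇒Pendant G (deepest-is-leaf deepest≢root depth≤deepest)

doubled-bound : ∀ {c} k → c ≤ 2 ^ k + suc k → c + c ≤ 2 ^ suc k + suc k + suc k
doubled-bound {c} k c≤ = begin
  c + c                              ≤⟨ +-mono-≤ c≤ c≤ ⟩
  (2 ^ k + suc k) + (2 ^ k + suc k)  ≡⟨ rearrange (2 ^ k) k ⟩
  2 ^ suc k + suc k + suc k ∎
  where
  open ≤-Reasoning
  rearrange : ∀ p k → (p + suc k) + (p + suc k) ≡ 2 * p + suc k + suc k
  rearrange = solve-∀

noc-bound : ∀ k (G : Graph (suc k)) → IsTree G → noc G ≤ 2 ^ k + suc k
noc-bound zero G _ = countSubsets-≤ 1 (isP3Convex? G)
noc-bound (suc k) G tree = via-leaf (leaf-exists G tree)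
  where
  via-leaf : (∃ λ r → ∃ (Pendant G r)) → noc G ≤ 2 ^ suc k + suc (suc k)
  via-leaf (r , r′ , pendant) = +-cancelʳ-≤ k (noc G) (2 ^ suc k + suc (suc k)) (begin
    noc G + k                  ≤⟨ noc+t≤2noc (W-Γ-≥ [] [] [] []) ⟩
    noc G′ + noc G′            ≤⟨ doubled-bound k (noc-bound k G′ tree′) ⟩
    2 ^ suc k + suc k + suc k  ≡⟨ +-suc (2 ^ suc k + suc k) k ⟩
    suc (2 ^ suc k + suc k + k) ≡⟨ cong (_+ k) (sym (+-suc (2 ^ suc k) (suc k))) ⟩
    2 ^ suc k + suc (suc k) + k ∎)
    where
    open ≤-Reasoning
    open PendantVertexOfTree G tree r r′ pendant
    open TouchingSets G′ tree′ r′ using (W-Γ-≥)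

proposition2p12 : (m : ℕ) (T : Graph (suc m)) → IsTree T
    → ¬ (T ≅ star (suc m)) → ¬ (T ≅ pathGraph (suc m))
    → (r : Fin (suc m)) → IsLeaf T r
    → (r′ : Fin m) → Edge T r (punchIn r r′)
    → ((suc m ∸ 1) + Γ (deleteVertex T r) r′ ≤ W (deleteVertex T r) r′)
    × (noc T < 2 ^ (suc m ∸ 1) + suc m)
    × (noc (star (suc m)) ≡ 2 ^ (suc m ∸ 1) + suc m)
proposition2p12 zero _ _ _ _ _ _ () _
proposition2p12 (suc k) T tree ¬star ¬path r leaf r′ r-edge = W-Γ-bound , noc-bound-strict , noc-star (suc k)
  where
  open PendantVertexOfTree T tree r r′ (r-edge , λ x e → leaf-neighbour-unique T leaf e r-edge)
  open TreeShape G′ tree′ r′ using (Shape; shape; extra; starlike; pathlike)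

  W-Γ-bound : suc k + Γ G′ r′ ≤ W G′ r′
  W-Γ-bound = from-shape shape
    where
    from-shape : Shape → suc k + Γ G′ r′ ≤ W G′ r′
    from-shape (extra S touching ¬chain) =
      TouchingSets.W-Γ-≥ G′ tree′ r′ (S ∷ []) ([] ∷ []) (touching ∷ []) (¬chain ∷ [])
    from-shape (starlike shallow) = ⊥-elim (¬star (StarIso.star-≅ T tree ρ̂ (shallow-lift shallow)))
    from-shape (pathlike injective) = ⊥-elim (¬path (PathIso.path-≅ T tree r (injective-lift injective)))

  noc-bound-strict : noc T < 2 ^ suc k + suc (suc k)
  noc-bound-strict = subst (noc T <_) (sym (+-suc (2 ^ suc k) (suc k)))
    (s≤s (+-cancelʳ-≤ (suc k) (noc T) (2 ^ suc k + suc k)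
      (≤-trans (noc+t≤2noc W-Γ-bound) (doubled-bound k (noc-bound k G′ tree′)))))
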